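{- Let $q>p\ge3$ be coprime integers, let $u$ be the integer with $0\le u<p$ and $uq\equiv1\pmod p$. Let $\langle p,q\rangle=\{iq+jp : i,j\in\mathbb{Z}_{\ge0}\}$, $\vartheta=(p-1)(q-1)/2$, list the elements of $\langle p,q\rangle\cap[0,(p-1)(q-1)]$ increasingly as $\ell_0<\dots<\ell_\vartheta$, and put $S_\Delta(p,q)=\{\ell_{j+1}-\ell_j : 0\le j\le\vartheta-1\}$. Let $D_\Delta(p,u)=\{b-a : (a,b)\in D\}$, where $D$ is the set of integer pairs $(a,b)$, $a<b$, with $\max(\langle ua\rangle_p,\langle ub\rangle_p)<\min_{a<n<b}\langle un\rangle_p$ (vacuous when $b=a+1$). Then $S_\Delta(p,q)\subseteq D_\Delta(p,u)$.
   Context: $\langle x\rangle_p$ denotes the least nonnegative residue of the integer $x$ modulo $p$. -}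

module Defs where

open import Data.Nat using (ℕ; zero; suc; _+_; _*_; _≡ᵇ_)
open import Data.Integer using (ℤ; _%ℕ_)
open import Data.Product using (∃₂)
open import Relation.Binary.PropositionalEquality using (_≡_)

-- ⟨ x ⟩ₚ : least nonnegative residue of the integer x modulo p
-- (for p = 0 we return 0 by convention; only p ≥ 3 is ever used)
res : ℕ → ℤ → ℕ
res zero    x = 0
res (suc k) x = x %ℕ suc k

InSG : ℕ → ℕ → ℕ → Set
InSG p q x = ∃₂ λ (i j : ℕ) → x ≡ i * q + j * p

{-# OPTIONS --safe #-}
module Submission where

-- Since u q ≡ 1 (mod p), r m = ⟨u m⟩_p is the residue of i in every representation
-- m = i q + j p, and the one with i = r m has the least q-coefficient; hence m ∈ ⟨p,q⟩
-- iff r m · q ≤ m. Take (a, b) = (x, y) and a gap element x < n < y. If r n ≤ r x, then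
-- r n · q ≤ r x · q ≤ x < n puts n in the semigroup. If r n ≤ r y, then
-- y − n ≡ (r y − r n) q (mod p) and y − n > (r y − r n) q, so y − n and with it
-- x + (y − n) lie in the semigroup, yet x < x + (y − n) < y.

open import Defs
open import Data.Nat using (ℕ; _*_; _∸_; _≤_; _<_; _⊔_)
open import Data.Nat.Coprimality using (Coprime)
open import Data.Integer using (ℤ; +_; _-_) renaming (_<_ to _<ℤ_; _*_ to _*ℤ_)
open import Data.Product using (∃₂; _×_)
open import Relation.Binary.PropositionalEquality using (_≡_)
open import Relation.Nullary using (¬_)

open import Data.Nat using (zero; suc; _+_; _%_; _/_; _≰_; NonZero)
open import Data.Nat.Properties
open import Data.Nat.DivMod
open import Data.Nat.Tactic.RingSolver using (solve)
open import Data.Integer using (+<+)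
open import Data.Integer.Properties using (pos-*; m-n≡m⊖n; ⊖-≥)
open import Data.Product using (∃-syntax; _,_)
open import Data.List using (_∷_; [])
open import Function using (_∘_)
open import Relation.Binary.PropositionalEquality using (refl; sym; trans; cong; cong₂; subst₂)
open ≤-Reasoning

[m%d*n]%d≡[m*n]%d : ∀ m n d .{{_ : NonZero d}} → m % d * n % d ≡ m * n % d
[m%d*n]%d≡[m*n]%d m n d = begin-equality
  m % d * n % d             ≡⟨ %-distribˡ-* (m % d) n d ⟩
  m % d % d * (n % d) % d   ≡⟨ cong (λ t → t * (n % d) % d) (m%n%n≡m%n m d) ⟩
  m % d * (n % d) % d       ≡⟨ %-distribˡ-* m n d ⟨
  m * n % d                 ∎

m%n≡o%n⇒m≡o+k*n : ∀ {m o} n .{{_ : NonZero n}} → o ≤ m → m % n ≡ o % n → ∃[ k ] m ≡ o + k * n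
m%n≡o%n⇒m≡o+k*n {m} {o} n o≤m m%n≡o%n = m / n ∸ o / n , (begin-equality
  m                                   ≡⟨ m≡m%n+[m/n]*n m n ⟩
  m % n + m / n * n                   ≡⟨ cong₂ (λ r d → r + d * n) m%n≡o%n (sym (m+[n∸m]≡n (/-monoˡ-≤ n o≤m))) ⟩
  o % n + (o / n + k) * n             ≡⟨ cong (_+_ (o % n)) (*-distribʳ-+ n (o / n) k) ⟩
  o % n + (o / n * n + k * n)         ≡⟨ +-assoc (o % n) (o / n * n) (k * n) ⟨
  o % n + o / n * n + k * n           ≡⟨ cong (_+ k * n) (m≡m%n+[m/n]*n o n) ⟨
  o + k * n                           ∎)
  where
  k = m / n ∸ o / n

module _ (p q u : ℕ) .{{_ : NonZero p}} (uq≡1 : u * q % p ≡ 1) where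

  r : ℕ → ℕ
  r m = u * m % p

  u*q*m≡m : ∀ m → u * q * m % p ≡ m % p
  u*q*m≡m m = begin-equality
    u * q * m % p        ≡⟨ [m%d*n]%d≡[m*n]%d (u * q) m p ⟨
    u * q % p * m % p    ≡⟨ cong (λ t → t * m % p) uq≡1 ⟩
    1 * m % p            ≡⟨ cong (_% p) (*-identityˡ m) ⟩
    m % p                ∎

  r[m]*q≡m : ∀ m → r m * q % p ≡ m % p
  r[m]*q≡m m = begin-equality
    u * m % p * q % p    ≡⟨ [m%d*n]%d≡[m*n]%d (u * m) q p ⟩
    u * m * q % p        ≡⟨ cong (_% p) (solve (u ∷ m ∷ q ∷ [])) ⟩
    u * q * m % p        ≡⟨ u*q*m≡m m ⟩
    m % p                ∎

  r[i*q+j*p]≡i%p : ∀ i j → r (i * q + j * p) ≡ i % p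
  r[i*q+j*p]≡i%p i j = begin-equality
    u * (i * q + j * p) % p      ≡⟨ cong (_% p) (solve (u ∷ i ∷ q ∷ j ∷ p ∷ [])) ⟩
    (u * q * i + u * j * p) % p  ≡⟨ [m+kn]%n≡m%n (u * q * i) (u * j) p ⟩
    u * q * i % p                ≡⟨ u*q*m≡m i ⟩
    i % p                        ∎

  InSG⇒r*q≤ : ∀ {m} → InSG p q m → r m * q ≤ m
  InSG⇒r*q≤ (i , j , refl) = begin
    r (i * q + j * p) * q  ≡⟨ cong (_* q) (r[i*q+j*p]≡i%p i j) ⟩
    i % p * q              ≤⟨ *-monoˡ-≤ q (m%n≤m i p) ⟩
    i * q                  ≤⟨ m≤m+n (i * q) (j * p) ⟩
    i * q + j * p          ∎

  r*q≤⇒m≡r*q+j*p : ∀ {m} → r m * q ≤ m → ∃[ j ] m ≡ r m * q + j * p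
  r*q≤⇒m≡r*q+j*p {m} r*q≤m = m%n≡o%n⇒m≡o+k*n p r*q≤m (sym (r[m]*q≡m m))

  r*q≤⇒InSG : ∀ {m} → r m * q ≤ m → InSG p q m
  r*q≤⇒InSG {m} r*q≤m = let j , m≡ = r*q≤⇒m≡r*q+j*p r*q≤m in r m , j , m≡

  ∉SG⇒r*q≡m+s*p : ∀ {m} → ¬ InSG p q m → ∃[ s ] r m * q ≡ m + s * p
  ∉SG⇒r*q≡m+s*p {m} m∉ = m%n≡o%n⇒m≡o+k*n p (<⇒≤ (≰⇒> (m∉ ∘ r*q≤⇒InSG))) (r[m]*q≡m m)

  InSG-+ : ∀ {a b} → InSG p q a → InSG p q b → InSG p q (a + b)
  InSG-+ (i , j , refl) (i′ , j′ , refl) =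
    i + i′ , j + j′ , solve (i ∷ j ∷ i′ ∷ j′ ∷ q ∷ p ∷ [])

  InSG-∸ : ∀ {n y} → ¬ InSG p q n → InSG p q y → r n ≤ r y → InSG p q (y ∸ n)
  InSG-∸ {n} {y} n∉ y∈ rn≤ry
    with s , rn*q≡n+s*p ← ∉SG⇒r*q≡m+s*p n∉
       | J , y≡ry*q+J*p ← r*q≤⇒m≡r*q+j*p (InSG⇒r*q≤ y∈)
    = k , J + s , (begin-equality
    y ∸ n                            ≡⟨ cong (_∸ n) y≡n+ ⟩
    n + (k * q + (J + s) * p) ∸ n    ≡⟨ m+n∸m≡n n _ ⟩
    k * q + (J + s) * p              ∎)
    where
    k = r y ∸ r n
    regroup : ∀ a d → a * q ≡ n + s * p → (a + d) * q + J * p ≡ n + (d * q + (J + s) * p)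
    regroup a d a*q≡ = begin-equality
      (a + d) * q + J * p            ≡⟨ solve (a ∷ d ∷ q ∷ J ∷ p ∷ []) ⟩
      a * q + (d * q + J * p)        ≡⟨ cong (_+ (d * q + J * p)) a*q≡ ⟩
      n + s * p + (d * q + J * p)    ≡⟨ solve (n ∷ s ∷ p ∷ d ∷ q ∷ J ∷ []) ⟩
      n + (d * q + (J + s) * p)      ∎
    y≡n+ : y ≡ n + (k * q + (J + s) * p)
    y≡n+ = begin-equality
      y                              ≡⟨ y≡ry*q+J*p ⟩
      r y * q + J * p                ≡⟨ cong (λ t → t * q + J * p) (m+[n∸m]≡n rn≤ry) ⟨
      (r n + k) * q + J * p          ≡⟨ regroup (r n) k rn*q≡n+s*p ⟩
      n + (k * q + (J + s) * p)      ∎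

  residue-gap : ∀ {x y n} → InSG p q x → InSG p q y → ((z : ℕ) → x < z → z < y → ¬ InSG p q z) →
                x < n → n < y → r x ⊔ r y < r n
  residue-gap {x} {y} {n} x∈ y∈ gap x<n n<y = ⊔-lub (≰⇒> rn≰rx) (≰⇒> rn≰ry)
    where
    n∉ : ¬ InSG p q n
    n∉ = gap n x<n n<y
    rn≰rx : r n ≰ r x
    rn≰rx rn≤rx = n∉ (r*q≤⇒InSG (begin
      r n * q  ≤⟨ *-monoˡ-≤ q rn≤rx ⟩
      r x * q  ≤⟨ InSG⇒r*q≤ x∈ ⟩
      x        <⟨ x<n ⟩
      n        ∎))
    rn≰ry : r n ≰ r y
    rn≰ry rn≤ry = gap (x + (y ∸ n)) x<x+[y∸n] x+[y∸n]<y (InSG-+ x∈ (InSG-∸ n∉ y∈ rn≤ry))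
      where
      x<x+[y∸n] : x < x + (y ∸ n)
      x<x+[y∸n] = m<m+n x (m<n⇒0<n∸m n<y)
      x+[y∸n]<y : x + (y ∸ n) < y
      x+[y∸n]<y = begin-strict
        x + (y ∸ n)  <⟨ +-monoˡ-< (y ∸ n) x<n ⟩
        n + (y ∸ n)  ≡⟨ m+[n∸m]≡n (<⇒≤ n<y) ⟩
        y            ∎

res-+* : ∀ k u m → res (suc k) (+ u *ℤ + m) ≡ u * m % suc k
res-+* k u m = cong (res (suc k)) (sym (pos-* u m))

lemma14 : (p q u : ℕ) → 3 ≤ p → p < q → Coprime p q →
          u < p → res p (+ (u * q)) ≡ 1 →
          (x y : ℕ) → InSG p q x → InSG p q y → y ≤ (p ∸ 1) * (q ∸ 1) → x < y →
          ((z : ℕ) → x < z → z < y → ¬ InSG p q z) →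
          ∃₂ λ (a b : ℤ) → a <ℤ b × b - a ≡ + (y ∸ x) ×
            ((n : ℤ) → a <ℤ n → n <ℤ b →
              res p (+ u *ℤ a) ⊔ res p (+ u *ℤ b) < res p (+ u *ℤ n))
lemma14 zero _ _ () _ _ _ _ _ _ _ _ _ _ _
lemma14 (suc k) q u _ _ _ _ uq≡1 x y x∈ y∈ _ x<y gap =
  + x , + y , +<+ x<y , trans (m-n≡m⊖n y x) (⊖-≥ (<⇒≤ x<y)) , residues
  where
  residues : (n : ℤ) → + x <ℤ n → n <ℤ + y →
             res (suc k) (+ u *ℤ + x) ⊔ res (suc k) (+ u *ℤ + y) < res (suc k) (+ u *ℤ n)
  residues (+ n) (+<+ x<n) (+<+ n<y) =
    subst₂ _<_ (sym (cong₂ _⊔_ (res-+* k u x) (res-+* k u y))) (sym (res-+* k u n))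
      (residue-gap (suc k) q u uq≡1 x∈ y∈ gap x<n n<y)
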